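{- Let $f(x),g_1(x),g_2(x)\in\mathbb{Z}[x]$ with $f(0)\neq0$ and $g_2\neq 0$, and suppose $f(x)^n=g_1(x^k)/g_2(x^k)$ for positive integers $k$ and $n$. Then there exists $h(x)\in\mathbb{Z}[x]$ such that $f(x)=h(x^k)$. -}

module Defs where

open import Data.Nat using (ℕ; zero; suc; _∸_)
open import Data.Integer using (ℤ; _+_; _*_; 0ℤ; 1ℤ)
open import Data.List using (List; []; _∷_; map; replicate; _++_)
open import Relation.Binary.PropositionalEquality using (_≡_)

-- Polynomials in ℤ[x], represented by coefficient lists (constant term first).
-- Trailing zeros are allowed; equality of polynomials is coefficientwise.
Poly : Set
Poly = List ℤ

coeff : Poly → ℕ → ℤ
coeff []      _       = 0ℤ
coeff (a ∷ p) zero    = a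
coeff (a ∷ p) (suc i) = coeff p i

_≈ₚ_ : Poly → Poly → Set
p ≈ₚ q = ∀ i → coeff p i ≡ coeff q i

IsZero : Poly → Set
IsZero p = ∀ i → coeff p i ≡ 0ℤ

_⊕_ : Poly → Poly → Poly
[]      ⊕ q       = q
(a ∷ p) ⊕ []      = a ∷ p
(a ∷ p) ⊕ (b ∷ q) = (a + b) ∷ (p ⊕ q)

_⊗_ : Poly → Poly → Poly
[]      ⊗ q = []
(a ∷ p) ⊗ q = map (a *_) q ⊕ (0ℤ ∷ (p ⊗ q))

_^ₚ_ : Poly → ℕ → Poly
p ^ₚ zero  = 1ℤ ∷ []
p ^ₚ suc n = p ⊗ (p ^ₚ n)

-- substitution x ↦ x^k, i.e. p(x) ↦ p(x^k) (intended for k ≥ 1):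
-- coefficient a_i is moved to position i·k.
expand : ℕ → Poly → Poly
expand k []      = []
expand k (a ∷ p) = a ∷ (replicate (k ∸ 1) 0ℤ ++ expand k p)

{-# OPTIONS --safe #-}
-- Suppose k ∤ m is the least index at which f = ∑ aᵢxⁱ has a coefficient a_m ≠ 0 off the
-- multiples of k. Below m, f involves only powers of x^k, so the coefficient of f^n at m is
-- n·a₀^(n−1)·a_m ≠ 0, and if b_t is the lowest nonzero coefficient of g₂, the coefficient of
-- f^n·g₂(x^k) at m + tk is that number times b_t. But k ∤ m + tk, so the coefficient of
-- g₁(x^k) there is 0: contradiction.
module Submission where

open import Defs
open import Data.Nat as ℕ using (ℕ; zero; suc; _∸_; _<_; _≤_; s≤s)
import Data.Nat.Properties as ℕ
open import Data.Nat.Divisibility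
  using (_∣_; divides; _∣?_; _∣0; ∣-refl; n∣m*n; ∣m+n∣m⇒∣n; ∣m∸n∣n⇒∣m)
open import Data.Integer using (ℤ; _+_; _*_; 0ℤ; 1ℤ; +_; _^_; _≟_)
import Data.Integer.Properties as ℤ
open import Data.Integer.Tactic.RingSolver using (solve-∀)
open import Data.List using ([]; _∷_; map; replicate; _++_; length; applyUpTo)
open import Data.List.Properties using (length-applyUpTo)
open import Data.Product using (∃; _,_; _×_)
open import Data.Sum using (_⊎_; inj₁; inj₂; [_,_]′)
open import Data.Empty using (⊥-elim)
open import Function using (_∘_)
open import Relation.Nullary using (¬_; yes; no)
open import Relation.Nullary.Decidable using (decidable-stable)
open import Relation.Binary.Definitions using (tri<; tri≈; tri>)
open import Relation.Binary.PropositionalEquality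
  using (_≡_; _≢_; refl; sym; trans; cong; cong₂; subst; module ≡-Reasoning)

open ≡-Reasoning

sumBelow : ℕ → (ℕ → ℤ) → ℤ
sumBelow zero    g = 0ℤ
sumBelow (suc n) g = g 0 + sumBelow n (g ∘ suc)

sumBelow-zero : ∀ n g → (∀ j → j < n → g j ≡ 0ℤ) → sumBelow n g ≡ 0ℤ
sumBelow-zero zero    g g≡0 = refl
sumBelow-zero (suc n) g g≡0 =
  cong₂ _+_ (g≡0 0 ℕ.z<s) (sumBelow-zero n (g ∘ suc) (λ j j<n → g≡0 (suc j) (s≤s j<n)))

sumBelow-single : ∀ n g a → a < n → (∀ j → j < n → j ≢ a → g j ≡ 0ℤ) → sumBelow n g ≡ g a
sumBelow-single (suc n) g zero _ g≡0 = begin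
  g 0 + sumBelow n (g ∘ suc) ≡⟨ cong (_+_ (g 0)) (sumBelow-zero n (g ∘ suc) (λ j j<n → g≡0 (suc j) (s≤s j<n) λ ())) ⟩
  g 0 + 0ℤ                   ≡⟨ ℤ.+-identityʳ (g 0) ⟩
  g 0                        ∎
sumBelow-single (suc n) g (suc a) (s≤s a<n) g≡0 = begin
  g 0 + sumBelow n (g ∘ suc) ≡⟨ cong₂ _+_ (g≡0 0 ℕ.z<s λ ()) (sumBelow-single n (g ∘ suc) a a<n g∘suc≡0) ⟩
  0ℤ + g (suc a)             ≡⟨ ℤ.+-identityˡ (g (suc a)) ⟩
  g (suc a)                  ∎
  where
  g∘suc≡0 : ∀ j → j < n → j ≢ a → g (suc j) ≡ 0ℤ
  g∘suc≡0 j j<n j≢a = g≡0 (suc j) (s≤s j<n) (j≢a ∘ ℕ.suc-injective)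

coeff-⊕ : ∀ p q i → coeff (p ⊕ q) i ≡ coeff p i + coeff q i
coeff-⊕ []      q       i       = sym (ℤ.+-identityˡ _)
coeff-⊕ (a ∷ p) []      i       = sym (ℤ.+-identityʳ _)
coeff-⊕ (a ∷ p) (b ∷ q) zero    = refl
coeff-⊕ (a ∷ p) (b ∷ q) (suc i) = coeff-⊕ p q i

coeff-map-* : ∀ a q i → coeff (map (a *_) q) i ≡ a * coeff q i
coeff-map-* a []      i       = sym (ℤ.*-zeroʳ a)
coeff-map-* a (b ∷ q) zero    = refl
coeff-map-* a (b ∷ q) (suc i) = coeff-map-* a q i

coeff-⊗ : ∀ p q i → coeff (p ⊗ q) i ≡ sumBelow (suc i) (λ j → coeff p j * coeff q (i ∸ j))
coeff-⊗ []      q i       = sym (sumBelow-zero (suc i) _ (λ _ _ → refl))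
coeff-⊗ (a ∷ p) q zero    = trans (coeff-⊕ (map (a *_) q) _ 0) (cong (_+ 0ℤ) (coeff-map-* a q 0))
coeff-⊗ (a ∷ p) q (suc i) =
  trans (coeff-⊕ (map (a *_) q) _ (suc i)) (cong₂ _+_ (coeff-map-* a q (suc i)) (coeff-⊗ p q i))

coeff-⊗-0 : ∀ p q → coeff (p ⊗ q) 0 ≡ coeff p 0 * coeff q 0
coeff-⊗-0 p q = trans (coeff-⊗ p q 0) (ℤ.+-identityʳ _)

coeff-^ₚ-0 : ∀ f n → coeff (f ^ₚ n) 0 ≡ coeff f 0 ^ n
coeff-^ₚ-0 f zero    = refl
coeff-^ₚ-0 f (suc n) = trans (coeff-⊗-0 f (f ^ₚ n)) (cong (coeff f 0 *_) (coeff-^ₚ-0 f n))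

coeff-≥length : ∀ p i → length p ≤ i → coeff p i ≡ 0ℤ
coeff-≥length []      i       _           = refl
coeff-≥length (a ∷ p) (suc i) (s≤s len≤i) = coeff-≥length p i len≤i

coeff-applyUpTo : ∀ g n i → i < n → coeff (applyUpTo g n) i ≡ g i
coeff-applyUpTo g (suc n) zero    _         = refl
coeff-applyUpTo g (suc n) (suc i) (s≤s i<n) = coeff-applyUpTo (g ∘ suc) n i i<n

lowestNonzero : ∀ p → IsZero p ⊎ ∃ λ t → coeff p t ≢ 0ℤ × (∀ i → i < t → coeff p i ≡ 0ℤ)
lowestNonzero [] = inj₁ (λ _ → refl)
lowestNonzero (a ∷ p) with a ≟ 0ℤ | lowestNonzero p
... | no a≢0  | _                         = inj₂ (0 , a≢0 , λ _ ())
... | yes a≡0 | inj₁ p≡0                  = inj₁ λ { zero → a≡0 ; (suc i) → p≡0 i }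
... | yes a≡0 | inj₂ (t , pₜ≢0 , below-t) =
  inj₂ (suc t , pₜ≢0 , λ { zero _ → a≡0 ; (suc i) (s≤s i<t) → below-t i i<t })

i≢0∧j≢0⇒i*j≢0 : ∀ {i j} → i ≢ 0ℤ → j ≢ 0ℤ → i * j ≢ 0ℤ
i≢0∧j≢0⇒i*j≢0 {i} i≢0 j≢0 ij≡0 = [ i≢0 , j≢0 ]′ (ℤ.i*j≡0⇒i≡0∨j≡0 i ij≡0)

∤m⇒∤m+n : ∀ {d m n} → ¬ d ∣ m → d ∣ n → ¬ d ∣ m ℕ.+ n
∤m⇒∤m+n {d} {m} {n} d∤m d∣n d∣m+n = d∤m (∣m+n∣m⇒∣n (subst (d ∣_) (ℕ.+-comm m n) d∣m+n) d∣n)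

∤m⇒∤m∸n : ∀ {d m n} → d ∣ n → n ≤ m → ¬ d ∣ m → ¬ d ∣ m ∸ n
∤m⇒∤m∸n d∣n n≤m d∤m d∣m∸n = d∤m (∣m∸n∣n⇒∣m _ n≤m d∣m∸n d∣n)

coeff-zeros++-< : ∀ k r i → i < k → coeff (replicate k 0ℤ ++ r) i ≡ 0ℤ
coeff-zeros++-< (suc k) r zero    _         = refl
coeff-zeros++-< (suc k) r (suc i) (s≤s i<k) = coeff-zeros++-< k r i i<k

coeff-zeros++-+ : ∀ k r i → coeff (replicate k 0ℤ ++ r) (k ℕ.+ i) ≡ coeff r i
coeff-zeros++-+ zero    r i = refl
coeff-zeros++-+ (suc k) r i = coeff-zeros++-+ k r i

coeff-expand-* : ∀ k h q → coeff (expand (suc k) h) (q ℕ.* suc k) ≡ coeff h q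
coeff-expand-* k []      q       = refl
coeff-expand-* k (a ∷ h) zero    = refl
coeff-expand-* k (a ∷ h) (suc q) =
  trans (coeff-zeros++-+ k (expand (suc k) h) (q ℕ.* suc k)) (coeff-expand-* k h q)

coeff-expand-∤ : ∀ k h i → ¬ suc k ∣ i → coeff (expand (suc k) h) i ≡ 0ℤ
coeff-expand-∤ k []      i       _   = refl
coeff-expand-∤ k (a ∷ h) zero    k∤i = ⊥-elim (k∤i (_ ∣0))
coeff-expand-∤ k (a ∷ h) (suc i) k∤i with i ℕ.<? k
... | yes i<k = coeff-zeros++-< k _ i i<k
... | no  i≮k = begin
  coeff (replicate k 0ℤ ++ expand (suc k) h) i           ≡⟨ cong (coeff (replicate k 0ℤ ++ expand (suc k) h)) (sym k+[i∸k]≡i) ⟩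
  coeff (replicate k 0ℤ ++ expand (suc k) h) (k ℕ.+ (i ∸ k)) ≡⟨ coeff-zeros++-+ k _ (i ∸ k) ⟩
  coeff (expand (suc k) h) (i ∸ k)                       ≡⟨ coeff-expand-∤ k h (i ∸ k) k∤i∸k ⟩
  0ℤ                                                     ∎
  where
  k+[i∸k]≡i : k ℕ.+ (i ∸ k) ≡ i
  k+[i∸k]≡i = ℕ.m+[n∸m]≡n (ℕ.≮⇒≥ i≮k)
  k∤i∸k : ¬ suc k ∣ i ∸ k
  k∤i∸k = ∤m⇒∤m∸n {n = suc k} ∣-refl (s≤s (ℕ.≮⇒≥ i≮k)) k∤i

expand-below : ∀ k g t → (∀ i → i < t → coeff g i ≡ 0ℤ) →
               ∀ i → i < t ℕ.* suc k → coeff (expand (suc k) g) i ≡ 0ℤ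
expand-below k g t below-t i i<tk with suc k ∣? i
... | no  k∤i          = coeff-expand-∤ k g i k∤i
... | yes (divides q refl) = trans (coeff-expand-* k g q) (below-t q (ℕ.*-cancelʳ-< (suc k) q t i<tk))

contract : ℕ → Poly → Poly
contract k f = applyUpTo (λ q → coeff f (q ℕ.* k)) (length f)

coeff-contract : ∀ k f q → coeff (contract (suc k) f) q ≡ coeff f (q ℕ.* suc k)
coeff-contract k f q with q ℕ.<? length f
... | yes q<len = coeff-applyUpTo _ (length f) q q<len
... | no  q≮len = begin
  coeff (contract (suc k) f) q ≡⟨ coeff-≥length (contract (suc k) f) q (subst (_≤ q) (sym (length-applyUpTo _ (length f))) len≤q) ⟩
  0ℤ                           ≡⟨ sym (coeff-≥length f _ (ℕ.≤-trans len≤q (ℕ.m≤m*n q (suc k)))) ⟩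
  coeff f (q ℕ.* suc k)        ∎
  where
  len≤q : length f ≤ q
  len≤q = ℕ.≮⇒≥ q≮len

≈expand-contract : ∀ k f → (∀ i → ¬ suc k ∣ i → coeff f i ≡ 0ℤ) → f ≈ₚ expand (suc k) (contract (suc k) f)
≈expand-contract k f f≡0 i with suc k ∣? i
... | no  k∤i              = trans (f≡0 i k∤i) (sym (coeff-expand-∤ k (contract (suc k) f) i k∤i))
... | yes (divides q refl) = sym (trans (coeff-expand-* k (contract (suc k) f) q) (coeff-contract k f q))

Sparse : ℕ → ℕ → Poly → Set
Sparse k m p = ∀ i → i < m → ¬ k ∣ i → coeff p i ≡ 0ℤ

sparse-1 : ∀ k m → Sparse k m (1ℤ ∷ [])
sparse-1 k m zero    _ k∤0 = ⊥-elim (k∤0 (_ ∣0))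
sparse-1 k m (suc i) _ _   = refl

sparse-⊗ : ∀ k m p q → Sparse k m p → Sparse k m q → Sparse k m (p ⊗ q)
sparse-⊗ k m p q p-sparse q-sparse i i<m k∤i =
  trans (coeff-⊗ p q i) (sumBelow-zero (suc i) _ term≡0)
  where
  term≡0 : ∀ j → j < suc i → coeff p j * coeff q (i ∸ j) ≡ 0ℤ
  term≡0 j (s≤s j≤i) with k ∣? j
  ... | yes k∣j = trans (cong (coeff p j *_) q[i∸j]≡0) (ℤ.*-zeroʳ (coeff p j))
    where q[i∸j]≡0 = q-sparse (i ∸ j) (ℕ.≤-<-trans (ℕ.m∸n≤m i j) i<m) (∤m⇒∤m∸n k∣j j≤i k∤i)
  ... | no  k∤j = cong (_* coeff q (i ∸ j)) (p-sparse j (ℕ.≤-<-trans j≤i i<m) k∤j)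

sparse-^ₚ : ∀ k m f n → Sparse k m f → Sparse k m (f ^ₚ n)
sparse-^ₚ k m f zero    f-sparse = sparse-1 k m
sparse-^ₚ k m f (suc n) f-sparse = sparse-⊗ k m f (f ^ₚ n) f-sparse (sparse-^ₚ k m f n f-sparse)

-- Below m all coefficients off the multiples of k vanish, so only the products with a factor of index 0 survive.
coeff-⊗-∤ : ∀ k m p q → Sparse k m p → Sparse k m q → ¬ k ∣ m →
            coeff (p ⊗ q) m ≡ coeff p 0 * coeff q m + coeff p m * coeff q 0
coeff-⊗-∤ k zero    p q _ _ k∤m = ⊥-elim (k∤m (_ ∣0))
coeff-⊗-∤ k (suc m) p q p-sparse q-sparse k∤m =
  trans (coeff-⊗ p q (suc m)) (cong (_+_ (coeff p 0 * coeff q (suc m))) (begin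
    sumBelow (suc m) (λ j → coeff p (suc j) * coeff q (m ∸ j)) ≡⟨ sumBelow-single (suc m) _ m (ℕ.n<1+n m) term≡0 ⟩
    coeff p (suc m) * coeff q (m ∸ m)                          ≡⟨ cong (λ i → coeff p (suc m) * coeff q i) (ℕ.n∸n≡0 m) ⟩
    coeff p (suc m) * coeff q 0                                ∎))
  where
  term≡0 : ∀ j → j < suc m → j ≢ m → coeff p (suc j) * coeff q (m ∸ j) ≡ 0ℤ
  term≡0 j (s≤s j≤m) j≢m with k ∣? suc j
  ... | yes k∣1+j = trans (cong (coeff p (suc j) *_) q[m∸j]≡0) (ℤ.*-zeroʳ (coeff p (suc j)))
    where q[m∸j]≡0 = q-sparse (m ∸ j) (s≤s (ℕ.m∸n≤m m j)) (∤m⇒∤m∸n k∣1+j (s≤s j≤m) k∤m)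
  ... | no  k∤1+j = cong (_* coeff q (m ∸ j)) (p-sparse (suc j) (s≤s (ℕ.≤∧≢⇒< j≤m j≢m)) k∤1+j)

coeff-^ₚ-∤ : ∀ k m f → Sparse k m f → ¬ k ∣ m → ∀ n →
             coeff (f ^ₚ suc n) m ≡ (+ suc n) * (coeff f 0 ^ n * coeff f m)
coeff-^ₚ-∤ k m f f-sparse k∤m zero = begin
  coeff (f ⊗ (1ℤ ∷ [])) m
    ≡⟨ coeff-⊗-∤ k m f _ f-sparse (sparse-1 k m) k∤m ⟩
  coeff f 0 * coeff (1ℤ ∷ []) m + coeff f m * 1ℤ
    ≡⟨ cong (λ c → coeff f 0 * c + coeff f m * 1ℤ) (sparse-1 k (suc m) m ℕ.≤-refl k∤m) ⟩
  coeff f 0 * 0ℤ + coeff f m * 1ℤ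
    ≡⟨ identity (coeff f 0) (coeff f m) ⟩
  (+ 1) * (1ℤ * coeff f m)
    ∎
  where
  identity : ∀ a b → a * 0ℤ + b * 1ℤ ≡ (+ 1) * (1ℤ * b)
  identity = solve-∀
coeff-^ₚ-∤ k m f f-sparse k∤m (suc n) = begin
  coeff (f ⊗ (f ^ₚ suc n)) m
    ≡⟨ coeff-⊗-∤ k m f _ f-sparse (sparse-^ₚ k m f (suc n) f-sparse) k∤m ⟩
  coeff f 0 * coeff (f ^ₚ suc n) m + coeff f m * coeff (f ^ₚ suc n) 0
    ≡⟨ cong₂ (λ c d → coeff f 0 * c + coeff f m * d) (coeff-^ₚ-∤ k m f f-sparse k∤m n) (coeff-^ₚ-0 f (suc n)) ⟩
  coeff f 0 * ((+ suc n) * (coeff f 0 ^ n * coeff f m)) + coeff f m * (coeff f 0 * coeff f 0 ^ n)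
    ≡⟨ identity (coeff f 0) (coeff f 0 ^ n) (coeff f m) (+ suc n) ⟩
  (1ℤ + (+ suc n)) * ((coeff f 0 * coeff f 0 ^ n) * coeff f m)
    ∎
  where
  identity : ∀ a aⁿ b c → a * (c * (aⁿ * b)) + b * (a * aⁿ) ≡ (1ℤ + c) * ((a * aⁿ) * b)
  identity = solve-∀

-- The lowest term b_t x^{tk} of g(x^k) is the only one that meets the coefficient of P at m.
coeff-⊗-expand : ∀ k m P g t → Sparse (suc k) m P → ¬ suc k ∣ m → (∀ i → i < t → coeff g i ≡ 0ℤ) →
                 coeff (P ⊗ expand (suc k) g) (m ℕ.+ t ℕ.* suc k) ≡ coeff P m * coeff g t
coeff-⊗-expand k m P g t P-sparse k∤m below-t = begin
  coeff (P ⊗ G) (m ℕ.+ T)                                           ≡⟨ coeff-⊗ P G (m ℕ.+ T) ⟩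
  sumBelow (suc (m ℕ.+ T)) (λ j → coeff P j * coeff G (m ℕ.+ T ∸ j)) ≡⟨ sumBelow-single _ _ m (s≤s (ℕ.m≤m+n m T)) term≡0 ⟩
  coeff P m * coeff G (m ℕ.+ T ∸ m)                                 ≡⟨ cong (λ i → coeff P m * coeff G i) (ℕ.m+n∸m≡n m T) ⟩
  coeff P m * coeff G T                                             ≡⟨ cong (coeff P m *_) (coeff-expand-* k g t) ⟩
  coeff P m * coeff g t                                             ∎
  where
  G = expand (suc k) g
  T = t ℕ.* suc k

  term≡0 : ∀ j → j < suc (m ℕ.+ T) → j ≢ m → coeff P j * coeff G (m ℕ.+ T ∸ j) ≡ 0ℤ
  term≡0 j (s≤s j≤m+T) j≢m with ℕ.<-cmp j m
  ... | tri≈ _ j≡m _ = ⊥-elim (j≢m j≡m)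
  ... | tri> _ _ m<j = trans (cong (coeff P j *_) (expand-below k g t below-t _ m+T∸j<T)) (ℤ.*-zeroʳ (coeff P j))
    where m+T∸j<T = subst (m ℕ.+ T ∸ j <_) (ℕ.m+n∸m≡n m T) (ℕ.∸-monoʳ-< m<j j≤m+T)
  ... | tri< j<m _ _ with suc k ∣? j
  ...   | no  k∤j = cong (_* coeff G (m ℕ.+ T ∸ j)) (P-sparse j j<m k∤j)
  ...   | yes k∣j = trans (cong (coeff P j *_) (coeff-expand-∤ k g _ k∤m+T∸j)) (ℤ.*-zeroʳ (coeff P j))
    where k∤m+T∸j = ∤m⇒∤m∸n k∣j j≤m+T (∤m⇒∤m+n k∤m (n∣m*n t))

coeff-∤-vanishes : ∀ f g₁ g₂ k n t → coeff f 0 ≢ 0ℤ →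
                   coeff g₂ t ≢ 0ℤ → (∀ i → i < t → coeff g₂ i ≡ 0ℤ) →
                   ((f ^ₚ suc n) ⊗ expand (suc k) g₂) ≈ₚ expand (suc k) g₁ →
                   ∀ m → Sparse (suc k) m f → ¬ suc k ∣ m → coeff f m ≡ 0ℤ
coeff-∤-vanishes f g₁ g₂ k n t f₀≢0 gₜ≢0 below-t eq m f-sparse k∤m =
  decidable-stable (coeff f m ≟ 0ℤ) (λ fₘ≢0 → product≢0 fₘ≢0 product≡0)
  where
  T = t ℕ.* suc k

  product≡0 : coeff (f ^ₚ suc n) m * coeff g₂ t ≡ 0ℤ
  product≡0 = begin
    coeff (f ^ₚ suc n) m * coeff g₂ t
      ≡⟨ sym (coeff-⊗-expand k m (f ^ₚ suc n) g₂ t (sparse-^ₚ (suc k) m f (suc n) f-sparse) k∤m below-t) ⟩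
    coeff ((f ^ₚ suc n) ⊗ expand (suc k) g₂) (m ℕ.+ T) ≡⟨ eq (m ℕ.+ T) ⟩
    coeff (expand (suc k) g₁) (m ℕ.+ T)               ≡⟨ coeff-expand-∤ k g₁ _ (∤m⇒∤m+n k∤m (n∣m*n t)) ⟩
    0ℤ                                                ∎

  product≢0 : coeff f m ≢ 0ℤ → coeff (f ^ₚ suc n) m * coeff g₂ t ≢ 0ℤ
  product≢0 fₘ≢0 = i≢0∧j≢0⇒i*j≢0 (subst (_≢ 0ℤ) (sym (coeff-^ₚ-∤ (suc k) m f f-sparse k∤m n)) fᵐ-coeff≢0) gₜ≢0
    where
    fᵐ-coeff≢0 : (+ suc n) * (coeff f 0 ^ n * coeff f m) ≢ 0ℤ
    fᵐ-coeff≢0 = i≢0∧j≢0⇒i*j≢0 {+ suc n} (λ ()) (i≢0∧j≢0⇒i*j≢0 (f₀≢0 ∘ ℤ.i^n≡0⇒i≡0 (coeff f 0) n) fₘ≢0)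

sparse-by-induction : ∀ k f → (∀ m → Sparse k m f → ¬ k ∣ m → coeff f m ≡ 0ℤ) → ∀ m → Sparse k m f
sparse-by-induction k f step (suc m) i (s≤s i≤m) k∤i with ℕ.m≤n⇒m<n∨m≡n i≤m
... | inj₁ i<m  = sparse-by-induction k f step m i i<m k∤i
... | inj₂ refl = step m (sparse-by-induction k f step m) k∤i

lemma8 : (f g₁ g₂ : Poly) (k n : ℕ) → 0 < k → 0 < n →
         coeff f 0 ≢ 0ℤ → ¬ IsZero g₂ →
         ((f ^ₚ n) ⊗ expand k g₂) ≈ₚ expand k g₁ →
         ∃ λ h → f ≈ₚ expand k h
lemma8 f g₁ g₂ (suc k) (suc n) _ _ f₀≢0 g₂≢0 eq with lowestNonzero g₂
... | inj₁ g₂≡0                 = ⊥-elim (g₂≢0 g₂≡0)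
... | inj₂ (t , gₜ≢0 , below-t) =
  contract (suc k) f , ≈expand-contract k f (λ i → f-sparse (suc i) i ℕ.≤-refl)
  where
  f-sparse : ∀ m → Sparse (suc k) m f
  f-sparse = sparse-by-induction (suc k) f (coeff-∤-vanishes f g₁ g₂ k n t f₀≢0 gₜ≢0 below-t eq)
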